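{- Let $(\mathcal{L},\mathcal{G})$ be an irreducible built lattice and $G\in\mathcal{G}\setminus\{\hat1\}$. Then the assignment $$e_H\mapsto\begin{cases}1\otimes e_H&\text{if }H\le G,\\ e_{G\vee H}\otimes1&\text{otherwise,}\end{cases}$$ for atoms $H$ of $\mathcal{L}$, defines a well-defined morphism of graded commutative algebras $\mathbb{OS}(\{G\}):\mathrm{OS}(\mathcal{L})\to\mathrm{OS}([G,\hat1])\otimes\mathrm{OS}([\hat0,G])$.
   Context: Geometric lattice: finite lattice with bottom $\hat0$, top $\hat1$, all maximal chains between comparable elements of equal length (rank $\rho$), with $\rho(X\wedge Y)+\rho(X\vee Y)\le\rho(X)+\rho(Y)$, every element a join of atoms; intervals are geometric, and for an atom $H\not\le G$, $G\vee H$ is an atom of $[G,\hat1]$. A building set of $\mathcal{L}$ is $\mathcal{G}\subset\mathcal{L}\setminus\{\hat0\}$ such that for every $X$, with $\mathrm{Fact}_{\mathcal{G}}(X)$ the maximal elements of $\mathcal{G}\cap[\hat0,X]$, the join map $\prod_{G\in\mathrm{Fact}_{\mathcal{G}}(X)}[\hat0,G]\to[\hat0,X]$ is a poset isomorphism; irreducible if $\hat1\in\mathcal{G}$. A circuit of $\mathcal{L}$ is a set $C$ of $n$ atoms with $\rho(\bigvee C)=n-1$ and $\rho(\bigvee C')=|C'|$ for all proper subsets $C'\subsetneq C$. The Orlik–Solomon algebra is $\mathrm{OS}(\mathcal{L})=\Lambda[e_H: H\text{ atom}]/\mathcal{I}$ (exterior algebra over $\mathbb{Z}$, generators in degree $1$),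 where $\mathcal{I}$ is generated by $\delta(e_{H_1}\wedge\dots\wedge e_{H_n})$ for all circuits $\{H_1,\dots,H_n\}$, $\delta$ being the unique derivation of degree $-1$ with $\delta(e_H)=1$. Tensor products of graded commutative algebras carry Koszul signs. -}

module Defs where

open import Data.Nat using (ℕ; zero; suc; _+_; _<_)
open import Data.Fin using (Fin; _≟_)
open import Data.Bool using (Bool; true; false; T; _∧_)
open import Data.Bool.Properties using (T?)
open import Data.List using (List; []; _∷_; _++_; map; foldr; length)
open import Data.List.Relation.Unary.All using (All)
open import Data.List.Membership.Propositional using (_∈_)
open import Data.List.Relation.Unary.Unique.Propositional using (Unique)
open import Data.Integer using (ℤ; +_; -_) renaming (_+_ to _+ℤ_; _*_ to _*ℤ_)
open import Data.Product using (Σ; ∃; _×_; _,_; proj₁; proj₂; map₂)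
open import Data.Sum using (_⊎_; inj₁; inj₂)
open import Relation.Nullary using (¬_; yes; no)
open import Relation.Nullary.Decidable using (⌊_⌋)
open import Relation.Binary.PropositionalEquality using (_≡_; _≢_)

record RawLattice : Set where
  field
    size : ℕ
    leᵇ  : Fin size → Fin size → Bool
    bot  : Fin size
    top  : Fin size
    _∨_  : Fin size → Fin size → Fin size
    _∧ₗ_ : Fin size → Fin size → Fin size
    ρ    : Fin size → ℕ
  infixr 6 _∨_

module Notions (L : RawLattice) where
  open RawLattice L public

  Elt : Set
  Elt = Fin size

  _≤_ : Elt → Elt → Set
  x ≤ y = T (leᵇ x y)

  _<ₗ_ : Elt → Elt → Set
  x <ₗ y = x ≤ y × x ≢ y

  _⋖_ : Elt → Elt → Set
  x ⋖ y = x <ₗ y × (∀ z → x ≤ z → z ≤ y → z ≡ x ⊎ z ≡ y)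

  IsAtom : Elt → Set
  IsAtom x = bot ⋖ x

  ⋁[_] : Elt → List Elt → Elt
  ⋁[ a ] cs = foldr _∨_ a cs

  ⋁ : List Elt → Elt
  ⋁ = ⋁[ bot ]

  -- Circuits of the interval [a, top] (rank of [a,top] is ρ - ρ a).
  -- For a = bot these are the circuits of L.
  IsCircuitFrom : Elt → List Elt → Set
  IsCircuitFrom a cs =
    Unique cs × All (a ⋖_) cs ×
    (ρ (⋁[ a ] cs) + 1 ≡ ρ a + length cs) ×
    (∀ ds → Unique ds → All (_∈ cs) ds → length ds < length cs →
       ρ (⋁[ a ] ds) ≡ ρ a + length ds)

  IsFact : (Elt → Set) → Elt → Elt → Set
  IsFact 𝒢 X F = 𝒢 F × F ≤ X × (∀ F' → 𝒢 F' → F ≤ F' → F' ≤ X → F' ≡ F)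

  -- the join map  ∏_{F ∈ fs} [bot, F] → [bot, X]  is a poset isomorphism;
  -- a tuple is a function y with y F ≤ F for each F in fs.
  JoinIso : Elt → List Elt → Set
  JoinIso X fs =
    (∀ Z → Z ≤ X → ∃ λ (y : Elt → Elt) → All (λ F → y F ≤ F) fs × ⋁ (map y fs) ≡ Z) ×
    (∀ (y y' : Elt → Elt) → All (λ F → y F ≤ F) fs → All (λ F → y' F ≤ F) fs →
       (All (λ F → y F ≤ y' F) fs → ⋁ (map y fs) ≤ ⋁ (map y' fs)) ×
       (⋁ (map y fs) ≤ ⋁ (map y' fs) → All (λ F → y F ≤ y' F) fs))

  IsBuildingSet : (Elt → Set) → Set
  IsBuildingSet 𝒢 =
    (∀ x → 𝒢 x → x ≢ bot) ×
    (∀ X (fs : List Elt) → (∀ F → (F ∈ fs → IsFact 𝒢 X F) × (IsFact 𝒢 X F → F ∈ fs)) →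
       JoinIso X fs)

  IsIrreducibleBuildingSet : (Elt → Set) → Set
  IsIrreducibleBuildingSet 𝒢 = IsBuildingSet 𝒢 × 𝒢 top

record IsGeometric (L : RawLattice) : Set where
  open Notions L
  field
    ≤-refl    : ∀ x → x ≤ x
    ≤-antisym : ∀ x y → x ≤ y → y ≤ x → x ≡ y
    ≤-trans   : ∀ x y z → x ≤ y → y ≤ z → x ≤ z
    bot-min   : ∀ x → bot ≤ x
    top-max   : ∀ x → x ≤ top
    ∨-ubˡ     : ∀ x y → x ≤ (x ∨ y)
    ∨-ubʳ     : ∀ x y → y ≤ (x ∨ y)
    ∨-lub     : ∀ x y z → x ≤ z → y ≤ z → (x ∨ y) ≤ z
    ∧-lbˡ     : ∀ x y → (x ∧ₗ y) ≤ x
    ∧-lbʳ     : ∀ x y → (x ∧ₗ y) ≤ y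
    ∧-glb     : ∀ x y z → z ≤ x → z ≤ y → z ≤ (x ∧ₗ y)
    ρ-bot     : ρ bot ≡ 0
    ρ-cover   : ∀ x y → x ⋖ y → ρ y ≡ suc (ρ x)
    semimodular : ∀ x y → ρ (x ∧ₗ y) + ρ (x ∨ y) Data.Nat.≤ ρ x + ρ y
    atomistic : ∀ x → ∃ λ as → All IsAtom as × ⋁ as ≡ x
    -- standard consequence recalled in the paper's context
    atom-lift : ∀ G H → IsAtom H → ¬ (H ≤ G) → G ⋖ (G ∨ H)

module Free (E : Set) where
  Word : Set
  Word = List E

  Poly : Set
  Poly = List (ℤ × Word)

  wordEq : (E → E → Bool) → Word → Word → Bool
  wordEq eq [] [] = true
  wordEq eq (a ∷ u) (b ∷ v) = eq a b ∧ wordEq eq u v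
  wordEq eq _ _ = false

  coeff : (E → E → Bool) → Poly → Word → ℤ
  coeff eq [] w = + 0
  coeff eq ((c , u) ∷ p) w with wordEq eq u w
  ... | true  = c +ℤ coeff eq p w
  ... | false = coeff eq p w

  PolyEq : (E → E → Bool) → Poly → Poly → Set
  PolyEq eq p q = ∀ w → coeff eq p w ≡ coeff eq q w

  sandwich : ℤ → Word → Poly → Word → Poly
  sandwich c u g v = map (λ t → (c *ℤ proj₁ t , u ++ proj₂ t ++ v)) g

  combine : List (ℤ × Word × Poly × Word) → Poly
  combine [] = []
  combine ((c , u , g , v) ∷ ts) = sandwich c u g v ++ combine ts

  genOf : ℤ × Word × Poly × Word → Poly
  genOf (c , u , g , v) = g

  InIdeal : (E → E → Bool) → (Poly → Set) → Poly → Set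
  InIdeal eq R p =
    Σ (List (ℤ × Word × Poly × Word)) λ ts → All (λ t → R (genOf t)) ts × PolyEq eq p (combine ts)

  ExtRel : Poly → Set
  ExtRel p = (∃ λ a → ∃ λ b → p ≡ ((+ 1 , a ∷ b ∷ []) ∷ (+ 1 , b ∷ a ∷ []) ∷ []))
           ⊎ (∃ λ a → p ≡ ((+ 1 , a ∷ a ∷ []) ∷ []))

  -- δ, the derivation of degree -1 with δ(e) = 1, on a monomial
  delta : Word → Poly
  delta [] = []
  delta (e ∷ w) = (+ 1 , w) ∷ map (λ t → (- proj₁ t , e ∷ proj₂ t)) (delta w)

module OSMap (L : RawLattice) where
  open Notions L

  AtomL : Set
  AtomL = Σ Elt IsAtom

  AtomUp : Elt → Set
  AtomUp G = Σ Elt (G ⋖_)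

  AtomDown : Elt → Set
  AtomDown G = Σ Elt (λ x → IsAtom x × x ≤ G)

  eqΣ : {P : Elt → Set} → Σ Elt P → Σ Elt P → Bool
  eqΣ a b = ⌊ proj₁ a ≟ proj₁ b ⌋

  eqSum : {A B : Set} → (A → A → Bool) → (B → B → Bool) → A ⊎ B → A ⊎ B → Bool
  eqSum ea eb (inj₁ a) (inj₁ a') = ea a a'
  eqSum ea eb (inj₂ b) (inj₂ b') = eb b b'
  eqSum ea eb _ _ = false

  -- generators of OS([G,top]) ⊗ OS([bot,G]): inj₁ = left factor, inj₂ = right factor
  TGen : Elt → Set
  TGen G = AtomUp G ⊎ AtomDown G

  eqT : (G : Elt) → TGen G → TGen G → Bool
  eqT G = eqSum eqΣ eqΣ

  SrcRel : Free.Poly AtomL → Set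
  SrcRel p = Free.ExtRel AtomL p
           ⊎ (∃ λ (cs : List AtomL) → IsCircuitFrom bot (map proj₁ cs) × p ≡ Free.delta AtomL cs)

  -- defining relations of OS([G,top]) ⊗ OS([bot,G]) as a quotient of the
  -- free algebra on the disjoint union of the atoms of both intervals
  TgtRel : (G : Elt) → Free.Poly (TGen G) → Set
  TgtRel G p = Free.ExtRel (TGen G) p
             ⊎ (∃ λ (cs : List (AtomUp G)) → IsCircuitFrom G (map proj₁ cs)
                  × p ≡ Free.delta (TGen G) (map inj₁ cs))
             ⊎ (∃ λ (cs : List (AtomDown G)) → IsCircuitFrom bot (map proj₁ cs)
                  × p ≡ Free.delta (TGen G) (map inj₂ cs))

  sendAtom : IsGeometric L → (G : Elt) → AtomL → TGen G
  sendAtom geo G (H , h) with T? (leᵇ H G)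
  ... | yes p = inj₂ (H , h , p)
  ... | no ¬p = inj₁ (G ∨ H , IsGeometric.atom-lift geo G H h ¬p)

  φ : IsGeometric L → (G : Elt) → Free.Poly AtomL → Free.Poly (TGen G)
  φ geo G = map (map₂ (map (sendAtom geo G)))

  InIdealSrc : Free.Poly AtomL → Set
  InIdealSrc = Free.InIdeal AtomL eqΣ SrcRel

  InIdealTgt : (G : Elt) → Free.Poly (TGen G) → Set
  InIdealTgt G = Free.InIdeal (TGen G) (eqT G) (TgtRel G)

module Submission where

-- Exterior relations are sent to exterior relations, so only the image of the boundary ∂e_C of a
-- circuit C needs attention. Split C into the atoms D below G and the atoms E not below G. If E is
-- empty, the image of ∂e_C is the boundary of the circuit D of [0̂, G]. Otherwise put X = ⋁C; since
-- D is a proper subset of C it is independent, so |D| ≤ ρ(G ∧ X), and semimodularity of G and X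
-- gives ρ(⋁{G ∨ H | H ∈ E}) ≤ ρG + ρX − |D| < ρG + |E|: the images of E form a dependent family of
-- atoms of [G, 1̂]. For a dependent family S, both e_S and ∂e_S lie in the Orlik–Solomon ideal (S has
-- a repeated atom or contains a circuit), and this pair of facts passes from a word to every word
-- containing it, in particular to the image of e_C.

open import Defs
open import Data.List using (List)
open import Relation.Binary.PropositionalEquality using (_≢_)
open RawLattice using (size; top)

module ListProperties where
  open import Data.Empty using (⊥-elim)
  open import Data.List using ([]; _∷_; _++_; map; length)
  import Data.List.Properties as List
  open import Data.List.Membership.Propositional using (_∈_; find)
  open import Data.List.Membership.Propositional.Properties using (∈-map⁺; ∈-map⁻; ∈-++⁺ˡ; ∈-++⁺ʳ; ∈-++⁻)
  open import Data.List.Relation.Binary.Sublist.Propositional using (_⊆_; []; _∷_; _∷ʳ_; from∈)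
  open import Data.List.Relation.Binary.Sublist.Propositional.Properties using (All-resp-⊆)
  open import Data.List.Relation.Unary.All as All using (All; _∷_)
  open import Data.List.Relation.Unary.All.Properties using (¬Any⇒All¬) renaming (map⁺ to All-map⁺)
  open import Data.List.Relation.Unary.AllPairs using ([]; _∷_)
  open import Data.List.Relation.Unary.Any using (here; there; _─_; any?)
  open import Data.List.Relation.Unary.Unique.Propositional using (Unique)
  open import Data.Nat using (_≤_; suc; s≤s; z≤n)
  open import Data.Product using (∃; _×_; _,_)
  open import Data.Sum using (_⊎_; inj₁; inj₂)
  open import Relation.Binary.Definitions using (DecidableEquality)
  open import Relation.Binary.PropositionalEquality using (_≡_; refl; sym; subst)
  open import Relation.Nullary using (yes; no)

  private variable A B : Set

  ∈-─ : ∀ {x y : A} {ys} (x∈ys : x ∈ ys) → y ∈ ys → x ≢ y → y ∈ (ys ─ x∈ys)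
  ∈-─ (here refl) (here refl) x≢y = ⊥-elim (x≢y refl)
  ∈-─ (here _)    (there y∈)  _   = y∈
  ∈-─ (there _)   (here y≡)   _   = here y≡
  ∈-─ (there x∈)  (there y∈)  x≢y = there (∈-─ x∈ y∈ x≢y)

  Unique⇒length≤ : ∀ {xs ys : List A} → Unique xs → All (_∈ ys) xs → length xs ≤ length ys
  Unique⇒length≤ {xs = []}          _             _              = z≤n
  Unique⇒length≤ {xs = x ∷ xs} {ys} (x∉xs ∷ uniq) (x∈ys ∷ xs⊆ys) =
    subst (suc (length xs) ≤_) (sym (List.length-removeAt′ ys _))
      (s≤s (Unique⇒length≤ uniq (All.zipWith (λ (x≢y , y∈ys) → ∈-─ x∈ys y∈ys x≢y) (x∉xs , xs⊆ys))))

  Unique-⊆ : ∀ {xs ys : List A} → xs ⊆ ys → Unique ys → Unique xs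
  Unique-⊆ []             []            = []
  Unique-⊆ (_ ∷ʳ xs⊆ys)   (_ ∷ uniq)    = Unique-⊆ xs⊆ys uniq
  Unique-⊆ (refl ∷ xs⊆ys) (y∉ys ∷ uniq) = All-resp-⊆ xs⊆ys y∉ys ∷ Unique-⊆ xs⊆ys uniq

  sublists : List A → List (List A)
  sublists []       = [] ∷ []
  sublists (x ∷ xs) = map (x ∷_) (sublists xs) ++ sublists xs

  ∈-sublists⁺ : ∀ {xs ys : List A} → xs ⊆ ys → xs ∈ sublists ys
  ∈-sublists⁺ []                         = here refl
  ∈-sublists⁺ {ys = y ∷ ys} (_ ∷ʳ xs⊆ys) = ∈-++⁺ʳ (map (y ∷_) (sublists ys)) (∈-sublists⁺ xs⊆ys)
  ∈-sublists⁺ (refl ∷ xs⊆ys)             = ∈-++⁺ˡ (∈-map⁺ _ (∈-sublists⁺ xs⊆ys))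

  ∈-sublists⁻ : ∀ {xs : List A} ys → xs ∈ sublists ys → xs ⊆ ys
  ∈-sublists⁻ []       (here refl) = []
  ∈-sublists⁻ (y ∷ ys) xs∈ with ∈-++⁻ (map (y ∷_) (sublists ys)) xs∈
  ... | inj₂ xs∈′ = y ∷ʳ ∈-sublists⁻ ys xs∈′
  ... | inj₁ xs∈′ with ∈-map⁻ (y ∷_) xs∈′
  ...   | _ , zs∈ , refl = refl ∷ ∈-sublists⁻ ys zs∈

  ⊆-map⁻ : (f : A → B) {xs : List B} (ys : List A) → xs ⊆ map f ys →
           ∃ λ zs → zs ⊆ ys × map f zs ≡ xs
  ⊆-map⁻ f []       []           = [] , [] , refl
  ⊆-map⁻ f (y ∷ ys) (_ ∷ʳ xs⊆)   with ⊆-map⁻ f ys xs⊆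
  ... | zs , zs⊆ys , refl = zs , y ∷ʳ zs⊆ys , refl
  ⊆-map⁻ f (y ∷ ys) (refl ∷ xs⊆) with ⊆-map⁻ f ys xs⊆
  ... | zs , zs⊆ys , refl = y ∷ zs , refl ∷ zs⊆ys , refl

  duplicate-or-Unique : (f : A → B) → DecidableEquality B → ∀ xs →
    (∃ λ a → ∃ λ a′ → f a ≡ f a′ × (a ∷ a′ ∷ []) ⊆ xs) ⊎ Unique (map f xs)
  duplicate-or-Unique f _≟_ []       = inj₂ []
  duplicate-or-Unique f _≟_ (x ∷ xs) with any? (λ y → f x ≟ f y) xs
  ... | yes fx∈fxs = let y , y∈xs , fx≡fy = find fx∈fxs in inj₁ (x , y , fx≡fy , refl ∷ from∈ y∈xs)
  ... | no  fx∉fxs with duplicate-or-Unique f _≟_ xs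
  ...   | inj₁ (a , a′ , fa≡fa′ , aa′⊆xs) = inj₁ (a , a′ , fa≡fa′ , x ∷ʳ aa′⊆xs)
  ...   | inj₂ uniq                       = inj₂ (All-map⁺ (¬Any⇒All¬ xs fx∉fxs) ∷ uniq)

module Combinations where
  open import Data.Bool using (Bool; true; false; T; not)
  open import Data.Bool.Properties using (T-≡; T-∧)
  open import Data.Empty using (⊥-elim)
  open import Data.Integer using (ℤ; 0ℤ; 1ℤ; -_; _+_; _*_; _-_)
  import Data.Integer.Properties as ℤ
  open import Data.Integer.Tactic.RingSolver using (solve-∀)
  open import Data.List using ([]; _∷_; _++_; map; length; filterᵇ)
  import Data.List.Properties as List
  open import Data.List.Relation.Binary.Sublist.Propositional using (_⊆_; []; _∷_; _∷ʳ_)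
  open import Data.List.Relation.Unary.All using (All; []; _∷_)
  open import Data.List.Relation.Unary.All.Properties using () renaming (++⁺ to All-++⁺; map⁺ to All-map⁺)
  open import Data.Nat using (ℕ; suc; s≤s; _≤_)
  import Data.Nat.Properties as ℕ
  open import Data.Product using (_×_; _,_; proj₁; proj₂; map₁; map₂)
  open import Data.Sum using (inj₁; inj₂)
  open import Function.Bundles using (module Equivalence)
  open import Relation.Binary.Structures using (IsEquivalence)
  open import Relation.Binary.PropositionalEquality using (_≡_; refl; sym; trans; cong; cong₂; subst)
  open Relation.Binary.PropositionalEquality.≡-Reasoning
  open Equivalence using (to; from)

  χ : Bool → ℤ
  χ true  = 1ℤ
  χ false = 0ℤ

  private variable K K′ : Set

  eval : (K → ℤ) → List (ℤ × K) → ℤ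
  eval h []            = 0ℤ
  eval h ((c , k) ∷ p) = c * h k + eval h p

  negate : List (ℤ × K) → List (ℤ × K)
  negate = map (map₁ (-_))

  eval-++ : ∀ (h : K → ℤ) p q → eval h (p ++ q) ≡ eval h p + eval h q
  eval-++ h []            q = sym (ℤ.+-identityˡ _)
  eval-++ h ((c , k) ∷ p) q =
    trans (cong (_+_ (c * h k)) (eval-++ h p q)) (sym (ℤ.+-assoc (c * h k) _ _))

  eval-scale : ∀ (h : K → ℤ) a p → eval h (map (map₁ (a *_)) p) ≡ a * eval h p
  eval-scale h a []            = sym (ℤ.*-zeroʳ a)
  eval-scale h a ((c , k) ∷ p) =
    trans (cong (_+_ (a * c * h k)) (eval-scale h a p)) (distrib a c (h k) (eval h p))
    where distrib : ∀ a c x y → a * c * x + a * y ≡ a * (c * x + y)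
          distrib = solve-∀

  eval-negate : ∀ (h : K → ℤ) p → eval h (negate p) ≡ - eval h p
  eval-negate h []            = refl
  eval-negate h ((c , k) ∷ p) =
    trans (cong (_+_ (- c * h k)) (eval-negate h p)) (distrib c (h k) (eval h p))
    where distrib : ∀ c x y → - c * x + - y ≡ - (c * x + y)
          distrib = solve-∀

  eval-map₂ : ∀ (h : K′ → ℤ) (f : K → K′) p → eval h (map (map₂ f) p) ≡ eval (λ k → h (f k)) p
  eval-map₂ h f []            = refl
  eval-map₂ h f ((c , k) ∷ p) = cong (_+_ (c * h (f k))) (eval-map₂ h f p)

  -- The keys are compared by a Boolean equivalence rather than by _≡_, because the letters of the
  -- Orlik–Solomon presentations carry proofs that are compared only through their lattice element.
  module Coefficients {K : Set} (_≈ᵇ_ : K → K → Bool)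
    (≈-isEquivalence : IsEquivalence (λ a b → T (a ≈ᵇ b))) where

    open IsEquivalence ≈-isEquivalence renaming (refl to ≈-refl; sym to ≈-sym; trans to ≈-trans)

    coefficient : List (ℤ × K) → K → ℤ
    coefficient p k = eval (λ a → χ (a ≈ᵇ k)) p

    Respects≈ : (K → ℤ) → Set
    Respects≈ h = ∀ {a b} → T (a ≈ᵇ b) → h a ≡ h b

    ≈ᵇ-congˡ : ∀ {a b} k → T (a ≈ᵇ b) → a ≈ᵇ k ≡ b ≈ᵇ k
    ≈ᵇ-congˡ {a} {b} k a≈b with a ≈ᵇ k in ak | b ≈ᵇ k in bk
    ... | true  | true  = refl
    ... | false | false = refl
    ... | true  | false = ⊥-elim (subst T bk (≈-trans (≈-sym a≈b) (from T-≡ ak)))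
    ... | false | true  = ⊥-elim (subst T ak (≈-trans a≈b (from T-≡ bk)))

    sameKey otherKeys : K → List (ℤ × K) → List (ℤ × K)
    sameKey   a = filterᵇ (λ t → a ≈ᵇ proj₂ t)
    otherKeys a = filterᵇ (λ t → not (a ≈ᵇ proj₂ t))

    eval-sameKey+otherKeys : ∀ h a p → eval h p ≡ eval h (sameKey a p) + eval h (otherKeys a p)
    eval-sameKey+otherKeys h a []            = refl
    eval-sameKey+otherKeys h a ((c , b) ∷ p) with a ≈ᵇ b
    ... | true  = trans (cong (_+_ (c * h b)) (eval-sameKey+otherKeys h a p)) (sym (ℤ.+-assoc (c * h b) _ _))
    ... | false = trans (cong (_+_ (c * h b)) (eval-sameKey+otherKeys h a p))
                        (swap (c * h b) (eval h (sameKey a p)) (eval h (otherKeys a p)))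
      where swap : ∀ x y z → x + (y + z) ≡ y + (x + z)
            swap = solve-∀

    eval-sameKey : ∀ {h} → Respects≈ h → ∀ a p → eval h (sameKey a p) ≡ coefficient (sameKey a p) a * h a
    eval-sameKey {h} resp a []            = refl
    eval-sameKey {h} resp a ((c , b) ∷ p) with a ≈ᵇ b in ab
    ... | false = eval-sameKey resp a p
    ... | true  = begin
      c * h b + eval h (sameKey a p)
        ≡⟨ cong₂ (λ x y → c * x + y) (resp (≈-sym a≈b)) (eval-sameKey resp a p) ⟩
      c * h a + coefficient (sameKey a p) a * h a
        ≡⟨ factor c (coefficient (sameKey a p) a) (h a) ⟩
      (c * 1ℤ + coefficient (sameKey a p) a) * h a
        ≡⟨ cong (λ v → (c * χ v + coefficient (sameKey a p) a) * h a) (sym (to T-≡ (≈-sym a≈b))) ⟩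
      (c * χ (b ≈ᵇ a) + coefficient (sameKey a p) a) * h a ∎
      where
        a≈b : T (a ≈ᵇ b)
        a≈b = from T-≡ ab
        factor : ∀ c g x → c * x + g * x ≡ (c * 1ℤ + g) * x
        factor = solve-∀

    coefficient-otherKeys : ∀ a k → T (a ≈ᵇ k) → ∀ p → coefficient (otherKeys a p) k ≡ 0ℤ
    coefficient-otherKeys a k a≈k []            = refl
    coefficient-otherKeys a k a≈k ((c , b) ∷ p) with a ≈ᵇ b in ab
    ... | true  = coefficient-otherKeys a k a≈k p
    ... | false with b ≈ᵇ k in bk
    ...   | true  = ⊥-elim (subst T ab (≈-trans a≈k (≈-sym (from T-≡ bk))))
    ...   | false = trans (cong (_+_ (c * 0ℤ)) (coefficient-otherKeys a k a≈k p)) (cong (_+ 0ℤ) (ℤ.*-zeroʳ c))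

    coefficient-sameKey : ∀ a k → a ≈ᵇ k ≡ false → ∀ p → coefficient (sameKey a p) k ≡ 0ℤ
    coefficient-sameKey a k a≉k []            = refl
    coefficient-sameKey a k a≉k ((c , b) ∷ p) with a ≈ᵇ b in ab
    ... | false = coefficient-sameKey a k a≉k p
    ... | true with b ≈ᵇ k in bk
    ...   | true  = ⊥-elim (subst T a≉k (≈-trans (from T-≡ ab) (from T-≡ bk)))
    ...   | false = trans (cong (_+_ (c * 0ℤ)) (coefficient-sameKey a k a≉k p)) (cong (_+ 0ℤ) (ℤ.*-zeroʳ c))

    Vanishing : List (ℤ × K) → Set
    Vanishing p = ∀ k → coefficient p k ≡ 0ℤ

    Vanishing-otherKeys : ∀ c a p → Vanishing ((c , a) ∷ p) → Vanishing (otherKeys a p)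
    Vanishing-otherKeys c a p vanish k with a ≈ᵇ k in ak
    ... | true  = coefficient-otherKeys a k (from T-≡ ak) p
    ... | false = begin
      coefficient (otherKeys a p) k                               ≡⟨ sym (ℤ.+-identityˡ _) ⟩
      0ℤ + coefficient (otherKeys a p) k                          ≡⟨ cong (_+ coefficient (otherKeys a p) k) (sym (coefficient-sameKey a k ak p)) ⟩
      coefficient (sameKey a p) k + coefficient (otherKeys a p) k ≡⟨ sym (eval-sameKey+otherKeys _ a p) ⟩
      coefficient p k                                             ≡⟨ sym (ℤ.+-identityˡ _) ⟩
      0ℤ + coefficient p k                                        ≡⟨ cong (_+ coefficient p k) (sym (ℤ.*-zeroʳ c)) ⟩
      c * χ false + coefficient p k                               ≡⟨ cong (λ v → c * χ v + coefficient p k) (sym ak) ⟩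
      coefficient ((c , a) ∷ p) k                                 ≡⟨ vanish k ⟩
      0ℤ                                                          ∎

    Vanishing-sameKey : ∀ c a p → Vanishing ((c , a) ∷ p) → c * 1ℤ + coefficient (sameKey a p) a ≡ 0ℤ
    Vanishing-sameKey c a p vanish = begin
      c * 1ℤ + coefficient (sameKey a p) a
        ≡⟨ sym (ℤ.+-identityʳ _) ⟩
      c * 1ℤ + coefficient (sameKey a p) a + 0ℤ
        ≡⟨ cong (_+_ (c * 1ℤ + coefficient (sameKey a p) a)) (sym (Vanishing-otherKeys c a p vanish a)) ⟩
      c * 1ℤ + coefficient (sameKey a p) a + coefficient (otherKeys a p) a
        ≡⟨ ℤ.+-assoc (c * 1ℤ) _ _ ⟩
      c * 1ℤ + (coefficient (sameKey a p) a + coefficient (otherKeys a p) a)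
        ≡⟨ cong₂ (λ v w → c * χ v + w) (sym (to T-≡ ≈-refl)) (sym (eval-sameKey+otherKeys _ a p)) ⟩
      coefficient ((c , a) ∷ p) a
        ≡⟨ vanish a ⟩
      0ℤ ∎

    private
      eval-vanishing : ∀ {h} → Respects≈ h → ∀ n p → length p ≤ n → Vanishing p → eval h p ≡ 0ℤ
      eval-vanishing resp n       []            _           _      = refl
      eval-vanishing {h} resp (suc n) ((c , a) ∷ p) (s≤s |p|≤n) vanish = begin
        c * h a + eval h p
          ≡⟨ cong (_+_ (c * h a)) (eval-sameKey+otherKeys h a p) ⟩
        c * h a + (eval h (sameKey a p) + eval h (otherKeys a p))
          ≡⟨ cong₂ (λ x y → c * h a + (x + y)) (eval-sameKey resp a p)
                   (eval-vanishing resp n (otherKeys a p) (ℕ.≤-trans (List.length-filter _ p) |p|≤n)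
                                   (Vanishing-otherKeys c a p vanish)) ⟩
        c * h a + (coefficient (sameKey a p) a * h a + 0ℤ)
          ≡⟨ factor c (coefficient (sameKey a p) a) (h a) ⟩
        (c * 1ℤ + coefficient (sameKey a p) a) * h a
          ≡⟨ cong (_* h a) (Vanishing-sameKey c a p vanish) ⟩
        0ℤ * h a
          ≡⟨ ℤ.*-zeroˡ (h a) ⟩
        0ℤ ∎
        where factor : ∀ c g x → c * x + (g * x + 0ℤ) ≡ (c * 1ℤ + g) * x
              factor = solve-∀

    eval-cong : ∀ {h} → Respects≈ h → ∀ p q → (∀ k → coefficient p k ≡ coefficient q k) → eval h p ≡ eval h q
    eval-cong {h} resp p q same = ℤ.i-j≡0⇒i≡j _ _
      (trans (sym (eval-difference h)) (eval-vanishing resp _ (p ++ negate q) ℕ.≤-refl difference-vanishes))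
      where
        eval-difference : ∀ h′ → eval h′ (p ++ negate q) ≡ eval h′ p - eval h′ q
        eval-difference h′ = trans (eval-++ h′ p (negate q)) (cong (_+_ (eval h′ p)) (eval-negate h′ q))
        difference-vanishes : Vanishing (p ++ negate q)
        difference-vanishes k = trans (eval-difference _)
          (trans (cong (_- coefficient q k) (same k)) (ℤ.+-inverseʳ (coefficient q k)))

  module FreeAlgebra {E : Set} (_≈ᵇ_ : E → E → Bool)
    (≈-isEquivalence : IsEquivalence (λ a b → T (a ≈ᵇ b))) where

    open Free E
    open IsEquivalence ≈-isEquivalence renaming (refl to ≈-refl; sym to ≈-sym; trans to ≈-trans)

    _≋ᵇ_ : Word → Word → Bool
    _≋ᵇ_ = wordEq _≈ᵇ_

    ≋-refl : ∀ u → T (u ≋ᵇ u)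
    ≋-refl []      = _
    ≋-refl (a ∷ u) = from T-∧ (≈-refl {a} , ≋-refl u)

    ≋-sym : ∀ {u v} → T (u ≋ᵇ v) → T (v ≋ᵇ u)
    ≋-sym {[]}    {[]}    _ = _
    ≋-sym {a ∷ u} {b ∷ v} p with to (T-∧ {a ≈ᵇ b}) p
    ... | a≈b , u≋v = from T-∧ (≈-sym {a} {b} a≈b , ≋-sym {u} {v} u≋v)

    ≋-trans : ∀ {u v w} → T (u ≋ᵇ v) → T (v ≋ᵇ w) → T (u ≋ᵇ w)
    ≋-trans {[]}    {[]}    {[]}    _ _ = _
    ≋-trans {a ∷ u} {b ∷ v} {c ∷ w} p q with to (T-∧ {a ≈ᵇ b}) p | to (T-∧ {b ≈ᵇ c}) q
    ... | a≈b , u≋v | b≈c , v≋w = from T-∧ (≈-trans {a} {b} {c} a≈b b≈c , ≋-trans {u} {v} {w} u≋v v≋w)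

    ≋-isEquivalence : IsEquivalence (λ u v → T (u ≋ᵇ v))
    ≋-isEquivalence = record
      { refl = λ {u} → ≋-refl u ; sym = λ {u} {v} → ≋-sym {u} {v} ; trans = λ {u} {v} {w} → ≋-trans {u} {v} {w} }

    ≋-++ : ∀ {u u′ v v′} → T (u ≋ᵇ u′) → T (v ≋ᵇ v′) → T ((u ++ v) ≋ᵇ (u′ ++ v′))
    ≋-++ {[]}    {[]}     _ q = q
    ≋-++ {a ∷ u} {b ∷ u′} {v} {v′} p q with to (T-∧ {a ≈ᵇ b}) p
    ... | a≈b , u≋u′ = from T-∧ (a≈b , ≋-++ {u} {u′} {v} {v′} u≋u′ q)

    open Coefficients _≋ᵇ_ ≋-isEquivalence public

    coeff≡coefficient : ∀ p w → coeff _≈ᵇ_ p w ≡ coefficient p w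
    coeff≡coefficient []            w = refl
    coeff≡coefficient ((c , u) ∷ p) w with u ≋ᵇ w
    ... | true  = cong₂ _+_ (sym (ℤ.*-identityʳ c)) (coeff≡coefficient p w)
    ... | false = trans (coeff≡coefficient p w)
                    (sym (trans (cong (_+ coefficient p w) (ℤ.*-zeroʳ c)) (ℤ.+-identityˡ _)))

    _≐_ : Poly → Poly → Set
    _≐_ = PolyEq _≈ᵇ_

    coefficient≡⇒≐ : ∀ p q → (∀ w → coefficient p w ≡ coefficient q w) → p ≐ q
    coefficient≡⇒≐ p q same w =
      trans (coeff≡coefficient p w) (trans (same w) (sym (coeff≡coefficient q w)))

    ≐⇒coefficient≡ : ∀ p q → p ≐ q → ∀ w → coefficient p w ≡ coefficient q w
    ≐⇒coefficient≡ p q p≐q w =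
      trans (sym (coeff≡coefficient p w)) (trans (p≐q w) (coeff≡coefficient q w))

    coefficient-sandwich : ∀ c u v p w →
      coefficient (sandwich c u p v) w ≡ c * eval (λ x → χ ((u ++ x ++ v) ≋ᵇ w)) p
    coefficient-sandwich c u v p w = begin
      coefficient (sandwich c u p v) w
        ≡⟨ cong (λ r → coefficient r w) (List.map-∘ p) ⟩
      coefficient (map (map₂ (λ x → u ++ x ++ v)) (map (map₁ (c *_)) p)) w
        ≡⟨ eval-map₂ _ (λ x → u ++ x ++ v) (map (map₁ (c *_)) p) ⟩
      eval (λ x → χ ((u ++ x ++ v) ≋ᵇ w)) (map (map₁ (c *_)) p)
        ≡⟨ eval-scale _ c p ⟩
      c * eval (λ x → χ ((u ++ x ++ v) ≋ᵇ w)) p ∎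

    ≋-inContext : ∀ u v {x y} → T (x ≋ᵇ y) → T ((u ++ x ++ v) ≋ᵇ (u ++ y ++ v))
    ≋-inContext u v {x} {y} x≋y =
      ≋-++ {u} {u} {x ++ v} {y ++ v} (≋-refl u) (≋-++ {x} {y} {v} {v} x≋y (≋-refl v))

    sandwich-cong : ∀ c u v {p q} → p ≐ q → sandwich c u p v ≐ sandwich c u q v
    sandwich-cong c u v {p} {q} p≐q = coefficient≡⇒≐ (sandwich c u p v) (sandwich c u q v) λ w → begin
      coefficient (sandwich c u p v) w           ≡⟨ coefficient-sandwich c u v p w ⟩
      c * eval (λ x → χ ((u ++ x ++ v) ≋ᵇ w)) p  ≡⟨ cong (c *_) (eval-cong (resp w) p q (≐⇒coefficient≡ p q p≐q)) ⟩
      c * eval (λ x → χ ((u ++ x ++ v) ≋ᵇ w)) q  ≡⟨ sym (coefficient-sandwich c u v q w) ⟩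
      coefficient (sandwich c u q v) w           ∎
      where
        resp : ∀ w → Respects≈ (λ x → χ ((u ++ x ++ v) ≋ᵇ w))
        resp w {x} {y} x≋y = cong χ (≈ᵇ-congˡ {u ++ x ++ v} {u ++ y ++ v} w (≋-inContext u v {x} {y} x≋y))

    module Ideal (R : Poly → Set) where

      InI : Poly → Set
      InI = InIdeal _≈ᵇ_ R

      InI-resp-≐ : ∀ {p q} → p ≐ q → InI q → InI p
      InI-resp-≐ {p} {q} p≐q (ts , gens , q≐ts) = ts , gens , λ w → trans (p≐q w) (q≐ts w)

      InI-coefficients : ∀ {p r} → InI p → (∀ w → coefficient r w ≡ coefficient p w) → InI r
      InI-coefficients {p} {r} p∈I same = InI-resp-≐ {r} {p} (coefficient≡⇒≐ r p same) p∈I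

      InI-[] : InI []
      InI-[] = [] , [] , λ w → refl

      InI-++ : ∀ {p q} → InI p → InI q → InI (p ++ q)
      InI-++ {p} {q} (ts , gs , p≐ts) (ts′ , gs′ , q≐ts′) =
        ts ++ ts′ , All-++⁺ gs gs′ , coefficient≡⇒≐ (p ++ q) (combine (ts ++ ts′)) λ w → begin
          coefficient (p ++ q) w
            ≡⟨ eval-++ _ p q ⟩
          coefficient p w + coefficient q w
            ≡⟨ cong₂ _+_ (≐⇒coefficient≡ p (combine ts) p≐ts w) (≐⇒coefficient≡ q (combine ts′) q≐ts′ w) ⟩
          coefficient (combine ts) w + coefficient (combine ts′) w
            ≡⟨ sym (eval-++ _ (combine ts) (combine ts′)) ⟩
          coefficient (combine ts ++ combine ts′) w
            ≡⟨ cong (λ r → coefficient r w) (sym (combine-++ ts ts′)) ⟩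
          coefficient (combine (ts ++ ts′)) w ∎
        where
          combine-++ : ∀ ts ts′ → combine (ts ++ ts′) ≡ combine ts ++ combine ts′
          combine-++ []                    ts′ = refl
          combine-++ ((c , u , g , v) ∷ ts) ts′ =
            trans (cong (sandwich c u g v ++_) (combine-++ ts ts′)) (sym (List.++-assoc (sandwich c u g v) _ _))

      private
        nest : ℤ → Word → Word → ℤ × Word × Poly × Word → ℤ × Word × Poly × Word
        nest c u v (c′ , u′ , g , v′) = (c * c′ , u ++ u′ , g , v′ ++ v)

        sandwich-sandwich : ∀ c u v c′ u′ v′ g →
          sandwich c u (sandwich c′ u′ g v′) v ≡ sandwich (c * c′) (u ++ u′) g (v′ ++ v)
        sandwich-sandwich c u v c′ u′ v′ g = trans (sym (List.map-∘ g)) (List.map-cong reassoc g)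
          where
            reassoc : ∀ t → (c * (c′ * proj₁ t) , u ++ (u′ ++ proj₂ t ++ v′) ++ v)
                          ≡ (c * c′ * proj₁ t , (u ++ u′) ++ proj₂ t ++ v′ ++ v)
            reassoc (d , x) = cong₂ _,_ (sym (ℤ.*-assoc c c′ d)) (begin
              u ++ (u′ ++ x ++ v′) ++ v    ≡⟨ cong (u ++_) (List.++-assoc u′ (x ++ v′) v) ⟩
              u ++ u′ ++ (x ++ v′) ++ v    ≡⟨ cong (λ y → u ++ u′ ++ y) (List.++-assoc x v′ v) ⟩
              u ++ u′ ++ x ++ v′ ++ v      ≡⟨ sym (List.++-assoc u u′ _) ⟩
              (u ++ u′) ++ x ++ v′ ++ v    ∎)

        sandwich-combine : ∀ c u v ts → sandwich c u (combine ts) v ≡ combine (map (nest c u v) ts)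
        sandwich-combine c u v []                      = refl
        sandwich-combine c u v ((c′ , u′ , g , v′) ∷ ts) =
          trans (List.map-++ _ (sandwich c′ u′ g v′) (combine ts))
                (cong₂ _++_ (sandwich-sandwich c u v c′ u′ v′ g) (sandwich-combine c u v ts))

      InI-sandwich : ∀ c u v {p} → InI p → InI (sandwich c u p v)
      InI-sandwich c u v {p} (ts , gens , p≐ts) =
        map (nest c u v) ts , All-map⁺ gens ,
        λ w → trans (sandwich-cong c u v {p} {combine ts} p≐ts w)
                    (cong (λ r → coeff _≈ᵇ_ r w) (sandwich-combine c u v ts))

      InI-generator : ∀ {g} → R g → InI g
      InI-generator {g} r = (1ℤ , [] , g , []) ∷ [] , r ∷ [] ,
        λ w → cong (λ p → coeff _≈ᵇ_ p w)
                   (sym (trans (List.++-identityʳ _) (trans (List.map-cong unit g) (List.map-id g))))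
        where unit : ∀ t → (1ℤ * proj₁ t , [] ++ proj₂ t ++ []) ≡ t
              unit (d , x) = cong₂ _,_ (ℤ.*-identityˡ d) (List.++-identityʳ x)

      InI-combine : ∀ ts → All (λ t → InI (genOf t)) ts → InI (combine ts)
      InI-combine []                      []           = InI-[]
      InI-combine ((c , u , g , v) ∷ ts) (g∈I ∷ ts∈I) =
        InI-++ {sandwich c u g v} {combine ts} (InI-sandwich c u v {g} g∈I) (InI-combine ts ts∈I)

      InI-negate : ∀ {p} → InI p → InI (negate p)
      InI-negate {p} p∈I = subst InI (List.map-cong minus p) (InI-sandwich (- 1ℤ) [] [] {p} p∈I)
        where minus : ∀ t → (- 1ℤ * proj₁ t , [] ++ proj₂ t ++ []) ≡ (- proj₁ t , proj₂ t)
              minus (d , x) = cong₂ _,_ (ℤ.-1*i≡-i d) (List.++-identityʳ x)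

      InI-difference : ∀ {p q r} → InI p → InI q →
                       (∀ w → coefficient r w ≡ coefficient p w - coefficient q w) → InI r
      InI-difference {p} {q} {r} p∈I q∈I r≡p-q = InI-coefficients {p ++ negate q} {r}
        (InI-++ {p} {negate q} p∈I (InI-negate {q} q∈I))
        λ w → trans (r≡p-q w)
                    (sym (trans (eval-++ _ p (negate q)) (cong (_+_ (coefficient p w)) (eval-negate _ q))))

  module Exterior {E : Set} (_≈ᵇ_ : E → E → Bool)
    (≈-isEquivalence : IsEquivalence (λ a b → T (a ≈ᵇ b)))
    (R : Free.Poly E → Set) (exteriorRelation : ∀ {p} → Free.ExtRel E p → R p) where

    open Free E
    open FreeAlgebra _≈ᵇ_ ≈-isEquivalence public
    open Ideal R public
    open IsEquivalence ≈-isEquivalence using () renaming (refl to ≈-refl; sym to ≈-sym)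

    monomial : Word → Poly
    monomial w = (1ℤ , w) ∷ []

    -- Unlike InI (delta w) alone, this pair is inherited by every word containing w (see Null-⊆),
    -- by the Leibniz rule ∂(e_a e_w) = e_w − e_a ∂e_w.
    Null : Word → Set
    Null w = InI (monomial w) × InI (delta w)

    altSign : Word → ℤ
    altSign []      = 1ℤ
    altSign (_ ∷ u) = - altSign u

    prependNeg : E → ℤ × Word → ℤ × Word
    prependNeg e (c , w) = (- c , e ∷ w)

    signedPrefix : Word → ℤ × Word → ℤ × Word
    signedPrefix u (c , w) = (altSign u * c , u ++ w)

    delta-++ : ∀ u v → delta (u ++ v) ≡ map (map₂ (_++ v)) (delta u) ++ map (signedPrefix u) (delta v)
    delta-++ []      v = sym (trans (List.map-cong (λ t → cong (_, proj₂ t) (ℤ.*-identityˡ (proj₁ t))) (delta v))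
                                    (List.map-id (delta v)))
    delta-++ (e ∷ u) v = cong ((1ℤ , u ++ v) ∷_) (begin
      map (prependNeg e) (delta (u ++ v))
        ≡⟨ cong (map (prependNeg e)) (delta-++ u v) ⟩
      map (prependNeg e) (map (map₂ (_++ v)) (delta u) ++ map (signedPrefix u) (delta v))
        ≡⟨ List.map-++ (prependNeg e) (map (map₂ (_++ v)) (delta u)) _ ⟩
      map (prependNeg e) (map (map₂ (_++ v)) (delta u)) ++ map (prependNeg e) (map (signedPrefix u) (delta v))
        ≡⟨ cong₂ _++_ (trans (sym (List.map-∘ (delta u))) (List.map-∘ (delta u)))
                      (trans (sym (List.map-∘ (delta v))) (List.map-cong negate-sign (delta v))) ⟩
      map (map₂ (_++ v)) (map (prependNeg e) (delta u)) ++ map (signedPrefix (e ∷ u)) (delta v) ∎)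
      where negate-sign : ∀ t → prependNeg e (signedPrefix u t) ≡ signedPrefix (e ∷ u) t
            negate-sign (c , w) = cong (_, e ∷ u ++ w) (ℤ.neg-distribˡ-* (altSign u) c)

    anticommutator : E → E → Poly
    anticommutator a b = (1ℤ , a ∷ b ∷ []) ∷ (1ℤ , b ∷ a ∷ []) ∷ []

    InI-anticommutator : ∀ a b → InI (anticommutator a b)
    InI-anticommutator a b = InI-generator (exteriorRelation (inj₁ (a , b , refl)))

    InI-square : ∀ a → InI (monomial (a ∷ a ∷ []))
    InI-square a = InI-generator (exteriorRelation (inj₂ (a , refl)))

    InI-swapped-pairs : ∀ {X : Set} a b (l : List X) (k : X → ℤ) (x y : X → Word) →
      InI (map (λ t → (k t , x t ++ a ∷ b ∷ y t)) l ++ map (λ t → (k t , x t ++ b ∷ a ∷ y t)) l)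
    InI-swapped-pairs a b []      k x y = InI-[]
    InI-swapped-pairs a b (t ∷ l) k x y =
      InI-coefficients {sandwich (k t) (x t) (anticommutator a b) (y t) ++ (ab ++ ba)} {map f (t ∷ l) ++ map g (t ∷ l)}
        (InI-++ {sandwich (k t) (x t) (anticommutator a b) (y t)} {ab ++ ba}
          (InI-sandwich (k t) (x t) (y t) (InI-anticommutator a b)) (InI-swapped-pairs a b l k x y))
        λ w → begin
          coefficient (map f (t ∷ l) ++ map g (t ∷ l)) w
            ≡⟨ eval-++ _ (map f (t ∷ l)) (map g (t ∷ l)) ⟩
          (k t * χ (ab-word ≋ᵇ w) + coefficient ab w) + (k t * χ (ba-word ≋ᵇ w) + coefficient ba w)
            ≡⟨ regroup (k t) (χ (ab-word ≋ᵇ w)) (χ (ba-word ≋ᵇ w)) (coefficient ab w) (coefficient ba w) ⟩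
          k t * (1ℤ * χ (ab-word ≋ᵇ w) + (1ℤ * χ (ba-word ≋ᵇ w) + 0ℤ)) + (coefficient ab w + coefficient ba w)
            ≡⟨ cong₂ _+_ (sym (coefficient-sandwich (k t) (x t) (y t) (anticommutator a b) w)) (sym (eval-++ _ ab ba)) ⟩
          coefficient (sandwich (k t) (x t) (anticommutator a b) (y t)) w + coefficient (ab ++ ba) w
            ≡⟨ sym (eval-++ _ (sandwich (k t) (x t) (anticommutator a b) (y t)) (ab ++ ba)) ⟩
          coefficient (sandwich (k t) (x t) (anticommutator a b) (y t) ++ (ab ++ ba)) w ∎
      where
        f = λ t → (k t , x t ++ a ∷ b ∷ y t)
        g = λ t → (k t , x t ++ b ∷ a ∷ y t)
        ab = map f l
        ba = map g l
        ab-word = x t ++ a ∷ b ∷ y t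
        ba-word = x t ++ b ∷ a ∷ y t
        regroup : ∀ k i j p q → (k * i + p) + (k * j + q) ≡ k * (1ℤ * i + (1ℤ * j + 0ℤ)) + (p + q)
        regroup = solve-∀

    InI-swap : ∀ u a b v → InI (monomial (u ++ a ∷ b ∷ v)) → InI (monomial (u ++ b ∷ a ∷ v))
    InI-swap u a b v uabv∈I =
      InI-difference {sandwich 1ℤ u (anticommutator a b) v} {monomial (u ++ a ∷ b ∷ v)} {monomial (u ++ b ∷ a ∷ v)}
        (InI-sandwich 1ℤ u v (InI-anticommutator a b)) uabv∈I λ w →
          trans (cancel (χ ((u ++ a ∷ b ∷ v) ≋ᵇ w)) (χ ((u ++ b ∷ a ∷ v) ≋ᵇ w)))
                (cong (_- coefficient (monomial (u ++ a ∷ b ∷ v)) w)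
                      (sym (coefficient-sandwich 1ℤ u v (anticommutator a b) w)))
      where cancel : ∀ i j → 1ℤ * j + 0ℤ ≡ 1ℤ * (1ℤ * i + (1ℤ * j + 0ℤ)) - (1ℤ * i + 0ℤ)
            cancel = solve-∀

    -- Expanding both boundaries by the Leibniz rule, the terms coming from ∂e_u and from ∂e_v pair up
    -- into anticommutator sandwiches, and the two terms from ∂(e_a e_b) exchange places.
    InI-delta-swap : ∀ u a b v → InI (delta (u ++ a ∷ b ∷ v)) → InI (delta (u ++ b ∷ a ∷ v))
    InI-delta-swap u a b v δuabv∈I =
      InI-difference {(ab₁ ++ ba₁) ++ (ab₂ ++ ba₂)} {delta (u ++ a ∷ b ∷ v)} {delta (u ++ b ∷ a ∷ v)}
        (InI-++ {ab₁ ++ ba₁} {ab₂ ++ ba₂} (InI-swapped-pairs a b (delta u) proj₁ proj₂ (λ _ → v))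
                                           (InI-swapped-pairs a b (delta v) (λ t → s * (- (- proj₁ t))) (λ _ → u) proj₂))
        δuabv∈I λ w → begin
          coefficient (delta (u ++ b ∷ a ∷ v)) w
            ≡⟨ cong (λ r → coefficient r w) (expand b a) ⟩
          coefficient (ba₁ ++ _) w
            ≡⟨ eval-++ _ ba₁ _ ⟩
          coefficient ba₁ w + (s * 1ℤ * χ ((u ++ a ∷ v) ≋ᵇ w) + (s * - 1ℤ * χ ((u ++ b ∷ v) ≋ᵇ w) + coefficient ba₂ w))
            ≡⟨ regroup s (coefficient ab₁ w) (coefficient ba₁ w) (coefficient ab₂ w) (coefficient ba₂ w)
                         (χ ((u ++ a ∷ v) ≋ᵇ w)) (χ ((u ++ b ∷ v) ≋ᵇ w)) ⟩
          ((coefficient ab₁ w + coefficient ba₁ w) + (coefficient ab₂ w + coefficient ba₂ w))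
            - (coefficient ab₁ w + (s * 1ℤ * χ ((u ++ b ∷ v) ≋ᵇ w) + (s * - 1ℤ * χ ((u ++ a ∷ v) ≋ᵇ w) + coefficient ab₂ w)))
            ≡⟨ cong₂ _-_
                 (sym (trans (eval-++ _ (ab₁ ++ ba₁) (ab₂ ++ ba₂)) (cong₂ _+_ (eval-++ _ ab₁ ba₁) (eval-++ _ ab₂ ba₂))))
                 (sym (trans (cong (λ r → coefficient r w) (expand a b)) (eval-++ _ ab₁ _))) ⟩
          coefficient ((ab₁ ++ ba₁) ++ (ab₂ ++ ba₂)) w - coefficient (delta (u ++ a ∷ b ∷ v)) w ∎
      where
        s = altSign u
        ab₁ = map (map₂ (_++ a ∷ b ∷ v)) (delta u)
        ba₁ = map (map₂ (_++ b ∷ a ∷ v)) (delta u)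
        ab₂ = map (λ t → (s * (- (- proj₁ t)) , u ++ a ∷ b ∷ proj₂ t)) (delta v)
        ba₂ = map (λ t → (s * (- (- proj₁ t)) , u ++ b ∷ a ∷ proj₂ t)) (delta v)
        expand : ∀ a b → delta (u ++ a ∷ b ∷ v) ≡
          map (map₂ (_++ a ∷ b ∷ v)) (delta u) ++
          ((s * 1ℤ , u ++ b ∷ v) ∷ (s * - 1ℤ , u ++ a ∷ v) ∷
           map (λ t → (s * (- (- proj₁ t)) , u ++ a ∷ b ∷ proj₂ t)) (delta v))
        expand a b = trans (delta-++ u (a ∷ b ∷ v))
          (cong (λ z → map (map₂ (_++ a ∷ b ∷ v)) (delta u) ++ ((s * 1ℤ , u ++ b ∷ v) ∷ (s * - 1ℤ , u ++ a ∷ v) ∷ z))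
                (trans (sym (List.map-∘ (map (prependNeg b) (delta v)))) (sym (List.map-∘ (delta v)))))
        regroup : ∀ s a₁ b₁ a₂ b₂ i j →
          b₁ + (s * 1ℤ * i + (s * - 1ℤ * j + b₂))
            ≡ ((a₁ + b₁) + (a₂ + b₂)) - (a₁ + (s * 1ℤ * j + (s * - 1ℤ * i + a₂)))
        regroup = solve-∀

    Null-swap : ∀ u a b v → Null (u ++ a ∷ b ∷ v) → Null (u ++ b ∷ a ∷ v)
    Null-swap u a b v (m∈I , δ∈I) = InI-swap u a b v m∈I , InI-delta-swap u a b v δ∈I

    Null-∷ : ∀ a w → Null w → Null (a ∷ w)
    Null-∷ a w (m∈I , δ∈I) =
      subst InI (cong (λ x → (1ℤ , a ∷ x) ∷ []) (List.++-identityʳ w)) (InI-sandwich 1ℤ (a ∷ []) [] {monomial w} m∈I) ,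
      InI-++ {monomial w} {map (prependNeg a) (delta w)} m∈I
        (subst InI (List.map-cong minus (delta w)) (InI-sandwich (- 1ℤ) (a ∷ []) [] {delta w} δ∈I))
      where minus : ∀ t → (- 1ℤ * proj₁ t , a ∷ proj₂ t ++ []) ≡ prependNeg a t
            minus (d , x) = cong₂ _,_ (ℤ.-1*i≡-i d) (cong (a ∷_) (List.++-identityʳ x))

    Null-move : ∀ a u v w → Null (u ++ a ∷ v ++ w) → Null (u ++ v ++ a ∷ w)
    Null-move a u []      w null = null
    Null-move a u (b ∷ v) w null =
      subst Null (List.++-assoc u (b ∷ []) (v ++ a ∷ w))
        (Null-move a (u ++ b ∷ []) v w
          (subst Null (sym (List.++-assoc u (b ∷ []) (a ∷ v ++ w))) (Null-swap u a b (v ++ w) null)))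

    Null-insert : ∀ a u w → Null (u ++ w) → Null (u ++ a ∷ w)
    Null-insert a u w null = Null-move a [] u w (Null-∷ a (u ++ w) null)

    Null-⊆ : ∀ u {v w} → v ⊆ w → Null (u ++ v) → Null (u ++ w)
    Null-⊆ u []                     null = null
    Null-⊆ u {v} {a ∷ w} (a ∷ʳ v⊆w) null = Null-insert a u w (Null-⊆ u v⊆w null)
    Null-⊆ u {a ∷ v} {a ∷ w} (refl ∷ v⊆w) null =
      subst Null (List.++-assoc u (a ∷ []) w)
        (Null-⊆ (u ++ a ∷ []) v⊆w (subst Null (sym (List.++-assoc u (a ∷ []) v)) null))

    Null-square : ∀ a a′ → T (a ≈ᵇ a′) → Null (a ∷ a′ ∷ [])
    Null-square a a′ a≈a′ =
      InI-coefficients {monomial (a ∷ a ∷ [])} {monomial (a ∷ a′ ∷ [])} (InI-square a)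
        (λ w → cong (λ b → 1ℤ * χ b + 0ℤ) (≈ᵇ-congˡ {a ∷ a′ ∷ []} {a ∷ a ∷ []} w
                 (from T-∧ (≈-refl {a} , from T-∧ (≈-sym {a} {a′} a≈a′ , _))))) ,
      InI-coefficients {[]} {delta (a ∷ a′ ∷ [])} InI-[]
        (λ w → trans (cong (λ b → 1ℤ * χ b + (- 1ℤ * χ ((a ∷ []) ≋ᵇ w) + 0ℤ))
                           (≈ᵇ-congˡ {a′ ∷ []} {a ∷ []} w (from T-∧ (≈-sym {a} {a′} a≈a′ , _))))
                     (cancel (χ ((a ∷ []) ≋ᵇ w))))
      where cancel : ∀ x → 1ℤ * x + (- 1ℤ * x + 0ℤ) ≡ 0ℤ
            cancel = solve-∀

    InI-squares : ∀ {X : Set} d (l : List X) (k : X → ℤ) (y : X → Word) → InI (map (λ t → (k t , d ∷ d ∷ y t)) l)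
    InI-squares d []      k y = InI-[]
    InI-squares d (t ∷ l) k y =
      InI-++ {(k t , d ∷ d ∷ y t) ∷ []} {map (λ t → (k t , d ∷ d ∷ y t)) l}
        (InI-coefficients {sandwich (k t) [] (monomial (d ∷ d ∷ [])) (y t)} {(k t , d ∷ d ∷ y t) ∷ []}
           (InI-sandwich (k t) [] (y t) {monomial (d ∷ d ∷ [])} (InI-square d))
           (λ w → scale (k t) (χ ((d ∷ d ∷ y t) ≋ᵇ w))))
        (InI-squares d l k y)
      where scale : ∀ k x → k * x + 0ℤ ≡ k * 1ℤ * x + 0ℤ
            scale = solve-∀

    -- e_d ∂(e_d e_w) = e_d e_w − e_d e_d ∂e_w.
    Null-of-InI-delta : ∀ d w → InI (delta (d ∷ w)) → Null (d ∷ w)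
    Null-of-InI-delta d w δ∈I = dw∈I , δ∈I
      where
        ddw = map (λ t → (- proj₁ t , d ∷ d ∷ proj₂ t)) (delta w)
        dδ≡ : sandwich 1ℤ (d ∷ []) (delta (d ∷ w)) [] ≡ monomial (d ∷ w) ++ ddw
        dδ≡ = cong₂ _∷_ (cong (λ x → (1ℤ , d ∷ x)) (List.++-identityʳ w))
                (trans (sym (List.map-∘ (delta w)))
                       (List.map-cong (λ t → cong₂ _,_ (ℤ.*-identityˡ _) (cong (λ x → d ∷ d ∷ x) (List.++-identityʳ (proj₂ t)))) (delta w)))
        dw∈I : InI (monomial (d ∷ w))
        dw∈I = InI-difference {monomial (d ∷ w) ++ ddw} {ddw} {monomial (d ∷ w)}
          (subst InI dδ≡ (InI-sandwich 1ℤ (d ∷ []) [] {delta (d ∷ w)} δ∈I))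
          (InI-squares d (delta w) (λ t → - proj₁ t) proj₂)
          λ v → trans (addSub (coefficient (monomial (d ∷ w)) v) (coefficient ddw v))
                      (cong (_- coefficient ddw v) (sym (eval-++ (λ x → χ (x ≋ᵇ v)) (monomial (d ∷ w)) ddw)))
          where addSub : ∀ x q → x ≡ (x + q) - q
                addSub = solve-∀


module GeometricLattice (L : RawLattice) (geo : IsGeometric L) where
  open import Data.Bool.Properties using (T?)
  open import Data.Empty using (⊥-elim)
  open import Data.Fin using () renaming (_≟_ to _≟ᶠ_)
  open import Data.List using ([]; _∷_; length; filter)
  open import Data.List.Membership.Propositional using (_∈_)
  open import Data.List.Membership.Propositional.Properties using (∈-filter⁺)
  open import Data.List.Relation.Binary.Sublist.Propositional using (_⊆_; _∷ʳ_; ⊆-refl)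
  open import Data.List.Relation.Binary.Sublist.Propositional.Properties using (filter-⊆)
  open import Data.List.Relation.Unary.All as All using (All; []; _∷_)
  open import Data.List.Relation.Unary.All.Properties using (all-filter)
  open import Data.List.Relation.Unary.Any using (here; there)
  open import Data.List.Relation.Unary.Unique.Propositional using (Unique)
  open import Data.Nat using (suc; _+_; _≤_; _<_; s≤s; _<?_)
  import Data.Nat.Properties as ℕ
  open import Data.Product using (_,_; proj₁)
  open import Relation.Binary.PropositionalEquality using (_≡_; refl; sym; trans; cong; subst)
  open import Relation.Nullary using (¬_; yes; no; Dec)
  open ListProperties
  open Notions L renaming (_≤_ to _≤ₗ_)
  open IsGeometric geo
  open import Data.List.Membership.DecPropositional (_≟ᶠ_ {RawLattice.size L}) using (_∈?_)

  base≤⋁ : ∀ a xs → a ≤ₗ ⋁[ a ] xs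
  base≤⋁ a []       = ≤-refl a
  base≤⋁ a (x ∷ xs) = ≤-trans _ _ _ (base≤⋁ a xs) (∨-ubʳ x _)

  ∈⇒≤⋁ : ∀ a {x} xs → x ∈ xs → x ≤ₗ ⋁[ a ] xs
  ∈⇒≤⋁ a (y ∷ xs) (here refl) = ∨-ubˡ y _
  ∈⇒≤⋁ a (y ∷ xs) (there x∈)  = ≤-trans _ _ _ (∈⇒≤⋁ a xs x∈) (∨-ubʳ y _)

  ⋁-least : ∀ a xs z → a ≤ₗ z → All (_≤ₗ z) xs → ⋁[ a ] xs ≤ₗ z
  ⋁-least a []       z a≤z []           = a≤z
  ⋁-least a (x ∷ xs) z a≤z (x≤z ∷ xs≤z) = ∨-lub x _ z x≤z (⋁-least a xs z a≤z xs≤z)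

  ⋁-mono-⊆ : ∀ a xs ys → All (_∈ ys) xs → ⋁[ a ] xs ≤ₗ ⋁[ a ] ys
  ⋁-mono-⊆ a xs ys xs⊆ys = ⋁-least a xs _ (base≤⋁ a ys) (All.map (∈⇒≤⋁ a ys) xs⊆ys)

  ⋁-mono-base : ∀ a b xs → a ≤ₗ b → ⋁[ a ] xs ≤ₗ ⋁[ b ] xs
  ⋁-mono-base a b []       a≤b = a≤b
  ⋁-mono-base a b (x ∷ xs) a≤b =
    ∨-lub x _ _ (∨-ubˡ x _) (≤-trans _ _ _ (⋁-mono-base a b xs a≤b) (∨-ubʳ x _))

  ∨-comm : ∀ x y → x ∨ y ≡ y ∨ x
  ∨-comm x y = ≤-antisym _ _ (∨-lub x y _ (∨-ubʳ y x) (∨-ubˡ y x)) (∨-lub y x _ (∨-ubʳ x y) (∨-ubˡ x y))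

  ρ-≤-∨atom : ∀ a z → IsAtom a → ρ z ≤ ρ (a ∨ z)
  ρ-≤-∨atom a z atom with T? (leᵇ a z)
  ... | yes a≤z = ℕ.≤-reflexive (cong ρ (≤-antisym _ _ (∨-ubʳ a z) (∨-lub a z z a≤z (≤-refl z))))
  ... | no  a≰z = subst (ρ z ≤_) (trans (sym (ρ-cover z (z ∨ a) (atom-lift z a atom a≰z))) (cong ρ (∨-comm z a)))
                        (ℕ.n≤1+n (ρ z))

  ρ-≤-⋁atoms : ∀ x as → All IsAtom as → ρ x ≤ ρ (⋁[ x ] as)
  ρ-≤-⋁atoms x []       []           = ℕ.≤-refl
  ρ-≤-⋁atoms x (a ∷ as) (atom ∷ atoms) = ℕ.≤-trans (ρ-≤-⋁atoms x as atoms) (ρ-≤-∨atom a _ atom)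

  ρ-mono : ∀ x y → x ≤ₗ y → ρ x ≤ ρ y
  ρ-mono x y x≤y with atomistic y
  ... | as , atoms , ⋁as≡y = subst (λ v → ρ x ≤ ρ v) ⋁[x]as≡y (ρ-≤-⋁atoms x as atoms)
    where
      ⋁[x]as≡y : ⋁[ x ] as ≡ y
      ⋁[x]as≡y = ≤-antisym _ _
        (⋁-least x as y x≤y (subst (λ v → All (_≤ₗ v) as) ⋁as≡y (All.tabulate (∈⇒≤⋁ bot as))))
        (subst (_≤ₗ ⋁[ x ] as) ⋁as≡y (⋁-mono-base bot x as (bot-min x)))

  ρ-∨cover≤ : ∀ {G x} Z → G ⋖ x → G ≤ₗ Z → ρ (x ∨ Z) ≤ suc (ρ Z)
  ρ-∨cover≤ {G} {x} Z G⋖x G≤Z = ℕ.+-cancelˡ-≤ (ρ G) _ _ (begin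
    ρ G + ρ (x ∨ Z)           ≤⟨ ℕ.+-monoˡ-≤ (ρ (x ∨ Z)) (ρ-mono G _ (∧-glb x Z G (proj₁ (proj₁ G⋖x)) G≤Z)) ⟩
    ρ (x ∧ₗ Z) + ρ (x ∨ Z)    ≤⟨ semimodular x Z ⟩
    ρ x + ρ Z                 ≡⟨ cong (_+ ρ Z) (ρ-cover G x G⋖x) ⟩
    suc (ρ G) + ρ Z           ≡⟨ sym (ℕ.+-suc (ρ G) (ρ Z)) ⟩
    ρ G + suc (ρ Z)           ∎)
    where open ℕ.≤-Reasoning

  ρ-⋁covers≤ : ∀ G xs → All (G ⋖_) xs → ρ (⋁[ G ] xs) ≤ ρ G + length xs
  ρ-⋁covers≤ G []       []           = ℕ.m≤m+n (ρ G) 0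
  ρ-⋁covers≤ G (x ∷ xs) (G⋖x ∷ G⋖xs) =
    ℕ.≤-trans (ρ-∨cover≤ (⋁[ G ] xs) G⋖x (base≤⋁ G xs))
      (subst (suc (ρ (⋁[ G ] xs)) ≤_) (sym (ℕ.+-suc (ρ G) (length xs))) (s≤s (ρ-⋁covers≤ G xs G⋖xs)))

  Dependent : Elt → List Elt → Set
  Dependent G s = ρ (⋁[ G ] s) < ρ G + length s

  dependent? : ∀ G s → Dec (Dependent G s)
  dependent? G s = ρ (⋁[ G ] s) <? ρ G + length s

  independent⇒ρ≥ : ∀ G s → ¬ Dependent G s → ρ G + length s ≤ ρ (⋁[ G ] s)
  independent⇒ρ≥ G s = ℕ.≮⇒≥

  ¬Dependent[] : ∀ G → ¬ Dependent G []
  ¬Dependent[] G dep = ℕ.n≮n (ρ G) (subst (ρ G <_) (ℕ.+-identityʳ (ρ G)) dep)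

  minimal-dependent⇒circuit : ∀ G s → Unique s → All (G ⋖_) s → Dependent G s →
    (∀ s′ → s′ ⊆ s → length s′ < length s → ¬ Dependent G s′) → IsCircuitFrom G s
  minimal-dependent⇒circuit G []       _    _    dep _       = ⊥-elim (¬Dependent[] G dep)
  minimal-dependent⇒circuit G (x ∷ s₀) uniq G⋖s dep minimal = uniq , G⋖s , rank , proper
    where
      s = x ∷ s₀
      rank : ρ (⋁[ G ] s) + 1 ≡ ρ G + length s
      rank = ℕ.≤-antisym (subst (_≤ ρ G + length s) (ℕ.+-comm 1 _) dep) (begin
        ρ G + length s           ≡⟨ ℕ.+-suc (ρ G) (length s₀) ⟩
        suc (ρ G + length s₀)    ≤⟨ s≤s (independent⇒ρ≥ G s₀ (minimal s₀ (x ∷ʳ ⊆-refl) ℕ.≤-refl)) ⟩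
        suc (ρ (⋁[ G ] s₀))      ≤⟨ s≤s (ρ-mono _ _ (∨-ubʳ x _)) ⟩
        suc (ρ (⋁[ G ] s))       ≡⟨ ℕ.+-comm 1 _ ⟩
        ρ (⋁[ G ] s) + 1         ∎)
        where open ℕ.≤-Reasoning
      proper : ∀ ds → Unique ds → All (_∈ s) ds → length ds < length s → ρ (⋁[ G ] ds) ≡ ρ G + length ds
      proper ds uniq-ds ds⊆s shorter = ℕ.≤-antisym (ρ-⋁covers≤ G ds (All.map (All.lookup G⋖s) ds⊆s)) (begin
        ρ G + length ds     ≤⟨ ℕ.+-monoʳ-≤ (ρ G) |ds|≤|s∩ds| ⟩
        ρ G + length s∩ds   ≤⟨ independent⇒ρ≥ G s∩ds (minimal s∩ds s∩ds⊆s (ℕ.≤-<-trans |s∩ds|≤|ds| shorter)) ⟩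
        ρ (⋁[ G ] s∩ds)     ≤⟨ ρ-mono _ _ (⋁-mono-⊆ G s∩ds ds (all-filter (_∈? ds) s)) ⟩
        ρ (⋁[ G ] ds)       ∎)
        where
          open ℕ.≤-Reasoning
          s∩ds = filter (_∈? ds) s
          s∩ds⊆s : s∩ds ⊆ s
          s∩ds⊆s = filter-⊆ (_∈? ds) s
          |s∩ds|≤|ds| : length s∩ds ≤ length ds
          |s∩ds|≤|ds| = Unique⇒length≤ (Unique-⊆ s∩ds⊆s uniq) (all-filter (_∈? ds) s)
          |ds|≤|s∩ds| : length ds ≤ length s∩ds
          |ds|≤|s∩ds| = Unique⇒length≤ uniq-ds (All.tabulate (λ d∈ds → ∈-filter⁺ (_∈? ds) (All.lookup ds⊆s d∈ds) d∈ds))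


module LetterEquality (L : RawLattice) where
  open import Data.Bool using (Bool; T)
  open import Data.Product using (Σ; proj₁)
  open import Data.Sum using (inj₁; inj₂)
  open import Relation.Binary.Structures using (IsEquivalence)
  open import Relation.Binary.PropositionalEquality using (_≡_; refl; sym; trans)
  open import Relation.Nullary.Decidable using (toWitness; fromWitness)
  open Notions L
  open OSMap L

  eqΣ⇒≡ : ∀ {P : Elt → Set} {a b : Σ Elt P} → T (eqΣ a b) → proj₁ a ≡ proj₁ b
  eqΣ⇒≡ = toWitness

  ≡⇒eqΣ : ∀ {P : Elt → Set} {a b : Σ Elt P} → proj₁ a ≡ proj₁ b → T (eqΣ {P} a b)
  ≡⇒eqΣ = fromWitness

  eqΣ-isEquivalence : ∀ {P : Elt → Set} → IsEquivalence (λ (a b : Σ Elt P) → T (eqΣ a b))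
  eqΣ-isEquivalence = record
    { refl  = λ {a} → ≡⇒eqΣ {a = a} {a} refl
    ; sym   = λ {a} {b} a≈b → ≡⇒eqΣ {a = b} {a} (sym (eqΣ⇒≡ {a = a} {b} a≈b))
    ; trans = λ {a} {b} {c} a≈b b≈c → ≡⇒eqΣ {a = a} {c} (trans (eqΣ⇒≡ {a = a} {b} a≈b) (eqΣ⇒≡ {a = b} {c} b≈c))
    }

  eqSum-isEquivalence : ∀ {A B : Set} {ea : A → A → Bool} {eb : B → B → Bool} →
    IsEquivalence (λ a a′ → T (ea a a′)) → IsEquivalence (λ b b′ → T (eb b b′)) →
    IsEquivalence (λ x y → T (eqSum ea eb x y))
  eqSum-isEquivalence {ea = ea} {eb} isEqᴬ isEqᴮ = record
    { refl = λ {x} → refl′ {x} ; sym = λ {x} {y} → sym′ {x} {y} ; trans = λ {x} {y} {z} → trans′ {x} {y} {z} }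
    where
      module A = IsEquivalence isEqᴬ
      module B = IsEquivalence isEqᴮ
      refl′ : ∀ {x} → T (eqSum ea eb x x)
      refl′ {inj₁ a} = A.refl {a}
      refl′ {inj₂ b} = B.refl {b}
      sym′ : ∀ {x y} → T (eqSum ea eb x y) → T (eqSum ea eb y x)
      sym′ {inj₁ a} {inj₁ a′} = A.sym {a} {a′}
      sym′ {inj₂ b} {inj₂ b′} = B.sym {b} {b′}
      trans′ : ∀ {x y z} → T (eqSum ea eb x y) → T (eqSum ea eb y z) → T (eqSum ea eb x z)
      trans′ {inj₁ a} {inj₁ a′} {inj₁ a″} = A.trans {a} {a′} {a″}
      trans′ {inj₂ b} {inj₂ b′} {inj₂ b″} = B.trans {b} {b′} {b″}

  eqT-isEquivalence : ∀ G → IsEquivalence (λ x y → T (eqT G x y))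
  eqT-isEquivalence G = eqSum-isEquivalence eqΣ-isEquivalence eqΣ-isEquivalence

module SendMap (L : RawLattice) (geo : IsGeometric L) (G : Notions.Elt L) where
  open import Data.Bool using (T)
  open import Data.Bool.Properties using (T?; T-∧)
  open import Data.Empty using (⊥-elim)
  open import Data.Fin using () renaming (_≟_ to _≟ᶠ_)
  open import Data.Integer using (ℤ; 1ℤ; _*_)
  open import Data.List using ([]; _∷_; _++_; map; length)
  import Data.List.Properties as List
  open import Data.List.Membership.Propositional using (_∈_; find; lose)
  open import Data.List.Relation.Binary.Sublist.Propositional using (_⊆_; []; _∷_; _∷ʳ_) renaming (lookup to ⊆-lookup)
  open import Data.List.Relation.Binary.Sublist.Propositional.Properties using () renaming (map⁺ to ⊆-map⁺)
  open import Data.List.Relation.Unary.All as All using (All; []; _∷_)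
  open import Data.List.Relation.Unary.All.Properties using () renaming (map⁺ to All-map⁺)
  open import Data.List.Relation.Unary.Any using (any?)
  open import Data.Nat using (suc; _+_; _≤_; _<_; _<?_; s≤s; z≤n)
  import Data.Nat.Properties as ℕ
  open import Data.Product using (_×_; _,_; proj₁; proj₂)
  open import Data.Sum using (inj₁; inj₂)
  open import Function.Bundles using (module Equivalence)
  open import Relation.Binary.PropositionalEquality using (_≡_; refl; sym; trans; cong; cong₂; subst; subst₂)
  open import Relation.Nullary using (¬_; yes; no)
  open import Relation.Nullary.Decidable using (_×-dec_)
  open Equivalence using (to; from)
  open Notions L renaming (_≤_ to _≤ₗ_)
  open OSMap L
  open IsGeometric geo
  open LetterEquality L
  open Combinations
  open GeometricLattice L geo
  open ListProperties

  open Exterior (eqT G) (eqT-isEquivalence G) (TgtRel G) inj₁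
  open Free (TGen G) using (Word; Poly; delta)
  module Source = FreeAlgebra eqΣ (eqΣ-isEquivalence {IsAtom})

  send : AtomL → TGen G
  send = sendAtom geo G

  data SendView : AtomL → TGen G → Set where
    below : ∀ {H} (h : IsAtom H) (H≤G : H ≤ₗ G) → SendView (H , h) (inj₂ (H , h , H≤G))
    above : ∀ {H} (h : IsAtom H) (H≰G : ¬ H ≤ₗ G) → SendView (H , h) (inj₁ (G ∨ H , atom-lift G H h H≰G))

  sendView : ∀ a → SendView a (send a)
  sendView (H , h) with T? (leᵇ H G)
  ... | yes H≤G = below h H≤G
  ... | no  H≰G = above h H≰G

  send-resp : ∀ {a b} → T (eqΣ a b) → T (eqT G (send a) (send b))
  send-resp {a} {b} a≈b with send a | sendView a | send b | sendView b | eqΣ⇒≡ {a = a} {b} a≈b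
  ... | _ | below {H} h H≤G | _ | below h′ H≤G′ | refl =
    ≡⇒eqΣ {λ x → IsAtom x × x ≤ₗ G} {H , h , H≤G} {H , h′ , H≤G′} refl
  ... | _ | above {H} h H≰G | _ | above h′ H≰G′ | refl =
    ≡⇒eqΣ {G ⋖_} {G ∨ H , atom-lift G H h H≰G} {G ∨ H , atom-lift G H h′ H≰G′} refl
  ... | _ | below _ H≤G | _ | above _ H≰G | refl = ⊥-elim (H≰G H≤G)
  ... | _ | above _ H≰G | _ | below _ H≤G | refl = ⊥-elim (H≰G H≤G)

  φG : Free.Poly AtomL → Poly
  φG = φ geo G

  sendWord-resp : ∀ {u v} → T (Source._≋ᵇ_ u v) → T (map send u ≋ᵇ map send v)
  sendWord-resp {[]}    {[]}    _ = _
  sendWord-resp {a ∷ u} {b ∷ v} a∷u≋b∷v with to (T-∧ {eqΣ a b}) a∷u≋b∷v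
  ... | a≈b , u≋v = from T-∧ (send-resp {a} {b} a≈b , sendWord-resp {u} {v} u≋v)

  φ-cong : ∀ p q → Source._≐_ p q → φG p ≐ φG q
  φ-cong p q p≐q = coefficient≡⇒≐ (φG p) (φG q) λ w → begin
    coefficient (φG p) w                          ≡⟨ eval-map₂ _ (map send) p ⟩
    eval (λ u → χ (map send u ≋ᵇ w)) p            ≡⟨ Source.eval-cong (λ {u} {v} u≋v →
                                                       cong χ (≈ᵇ-congˡ {map send u} {map send v} w (sendWord-resp {u} {v} u≋v)))
                                                       p q (Source.≐⇒coefficient≡ p q p≐q) ⟩
    eval (λ u → χ (map send u ≋ᵇ w)) q            ≡⟨ sym (eval-map₂ _ (map send) q) ⟩
    coefficient (φG q) w                          ∎
    where open Relation.Binary.PropositionalEquality.≡-Reasoning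

  φ-sandwich : ∀ c u g v →
    φG (Free.sandwich AtomL c u g v) ≡ Free.sandwich (TGen G) c (map send u) (φG g) (map send v)
  φ-sandwich c u g v = trans (sym (List.map-∘ g)) (trans (List.map-cong map-++³ g) (List.map-∘ g))
    where
      map-++³ : ∀ t → (c * proj₁ t , map send (u ++ proj₂ t ++ v))
                    ≡ (c * proj₁ t , map send u ++ map send (proj₂ t) ++ map send v)
      map-++³ t = cong (c * proj₁ t ,_)
        (trans (List.map-++ send u _) (cong (map send u ++_) (List.map-++ send (proj₂ t) v)))

  φTerm : ℤ × Free.Word AtomL × Free.Poly AtomL × Free.Word AtomL → ℤ × Word × Poly × Word
  φTerm (c , u , g , v) = (c , map send u , φG g , map send v)

  φ-combine : ∀ ts → φG (Free.combine AtomL ts) ≡ Free.combine (TGen G) (map φTerm ts)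
  φ-combine []                      = refl
  φ-combine ((c , u , g , v) ∷ ts) =
    trans (List.map-++ _ (Free.sandwich AtomL c u g v) _) (cong₂ _++_ (φ-sandwich c u g v) (φ-combine ts))

  φ-delta : ∀ w → φG (Free.delta AtomL w) ≡ delta (map send w)
  φ-delta []      = refl
  φ-delta (e ∷ w) = cong ((1ℤ , map send w) ∷_)
    (trans (sym (List.map-∘ (Free.delta AtomL w)))
      (trans (List.map-∘ (Free.delta AtomL w)) (cong (map (prependNeg (send e))) (φ-delta w))))

  ups : Word → List (AtomUp G)
  ups []           = []
  ups (inj₁ y ∷ w) = y ∷ ups w
  ups (inj₂ _ ∷ w) = ups w

  downs : Word → List (AtomDown G)
  downs []           = []
  downs (inj₁ _ ∷ w) = downs w
  downs (inj₂ x ∷ w) = x ∷ downs w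

  ups-⊆ : ∀ w → map inj₁ (ups w) ⊆ w
  ups-⊆ []           = []
  ups-⊆ (inj₁ y ∷ w) = refl ∷ ups-⊆ w
  ups-⊆ (inj₂ x ∷ w) = inj₂ x ∷ʳ ups-⊆ w

  length-ups+downs : ∀ w → length (ups w) + length (downs w) ≡ length w
  length-ups+downs []           = refl
  length-ups+downs (inj₁ _ ∷ w) = cong suc (length-ups+downs w)
  length-ups+downs (inj₂ _ ∷ w) = trans (ℕ.+-suc (length (ups w)) _) (cong suc (length-ups+downs w))

  downs≤G : ∀ w → All (_≤ₗ G) (map proj₁ (downs w))
  downs≤G []                       = []
  downs≤G (inj₁ _ ∷ w)             = downs≤G w
  downs≤G (inj₂ (_ , _ , x≤G) ∷ w) = x≤G ∷ downs≤G w

  downs-send-⊆ : ∀ cs → map proj₁ (downs (map send cs)) ⊆ map proj₁ cs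
  downs-send-⊆ []       = []
  downs-send-⊆ (a ∷ cs) with send a | sendView a
  ... | _ | below _ _ = refl ∷ downs-send-⊆ cs
  ... | _ | above {H} _ _ = H ∷ʳ downs-send-⊆ cs

  ups-send-≤ : ∀ cs z → G ≤ₗ z → All (_≤ₗ z) (map proj₁ cs) → All (_≤ₗ z) (map proj₁ (ups (map send cs)))
  ups-send-≤ []       z G≤z []              = []
  ups-send-≤ (a ∷ cs) z G≤z (H≤z ∷ cs≤z) with send a | sendView a
  ... | _ | below _ _ = ups-send-≤ cs z G≤z cs≤z
  ... | _ | above {H} _ _ = ∨-lub G H z G≤z H≤z ∷ ups-send-≤ cs z G≤z cs≤z

  no-ups⇒all-below : ∀ cs → ups (map send cs) ≡ [] →
    map inj₂ (downs (map send cs)) ≡ map send cs × map proj₁ (downs (map send cs)) ≡ map proj₁ cs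
  no-ups⇒all-below []       _ = refl , refl
  no-ups⇒all-below (a ∷ cs) no-ups with send a | sendView a
  ... | _ | above _ _ with () ← no-ups
  ... | _ | below _ _ with no-ups⇒all-below cs no-ups
  ...   | same-words , same-atoms = cong (_ ∷_) same-words , cong (_ ∷_) same-atoms

  atomsOf : List AtomL → List Elt
  atomsOf = map proj₁

  upAtoms downAtoms : List AtomL → List Elt
  upAtoms   cs = map proj₁ (ups (map send cs))
  downAtoms cs = map proj₁ (downs (map send cs))

  length-upAtoms+downAtoms : ∀ cs → length (upAtoms cs) + length (downAtoms cs) ≡ length (atomsOf cs)
  length-upAtoms+downAtoms cs = begin
    length (upAtoms cs) + length (downAtoms cs)               ≡⟨ cong₂ _+_ (List.length-map proj₁ (ups (map send cs)))
                                                                           (List.length-map proj₁ (downs (map send cs))) ⟩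
    length (ups (map send cs)) + length (downs (map send cs)) ≡⟨ length-ups+downs (map send cs) ⟩
    length (map send cs)                                      ≡⟨ List.length-map send cs ⟩
    length cs                                                 ≡⟨ sym (List.length-map proj₁ cs) ⟩
    length (atomsOf cs)                                       ∎
    where open Relation.Binary.PropositionalEquality.≡-Reasoning

  downAtoms-of-circuit-≤ρ∧ : ∀ cs → IsCircuitFrom bot (atomsOf cs) → ∀ {y ys} → ups (map send cs) ≡ y ∷ ys →
                             length (downAtoms cs) ≤ ρ (G ∧ₗ ⋁ (atomsOf cs))
  downAtoms-of-circuit-≤ρ∧ cs (uniq , _ , _ , proper) has-ups =
    subst (_≤ ρ (G ∧ₗ ⋁ (atomsOf cs))) ρ⋁Ds≡|Ds| (ρ-mono _ _ (∧-glb G _ _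
      (⋁-least bot (downAtoms cs) G (bot-min G) (downs≤G (map send cs)))
      (⋁-mono-⊆ bot (downAtoms cs) (atomsOf cs) Ds∈cs)))
    where
      Ds∈cs : All (_∈ atomsOf cs) (downAtoms cs)
      Ds∈cs = All.tabulate (⊆-lookup (downs-send-⊆ cs))
      |Ds|<|cs| : length (downAtoms cs) < length (atomsOf cs)
      |Ds|<|cs| = subst (length (downAtoms cs) <_) (length-upAtoms+downAtoms cs)
        (ℕ.+-monoˡ-≤ (length (downAtoms cs)) (subst (λ l → 1 ≤ length (map proj₁ l)) (sym has-ups) (s≤s z≤n)))
      ρ⋁Ds≡|Ds| : ρ (⋁ (downAtoms cs)) ≡ length (downAtoms cs)
      ρ⋁Ds≡|Ds| = trans (proper (downAtoms cs) (Unique-⊆ (downs-send-⊆ cs) uniq) Ds∈cs |Ds|<|cs|)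
                        (cong (_+ length (downAtoms cs)) ρ-bot)

  upAtoms-of-circuit-dependent : ∀ cs → IsCircuitFrom bot (atomsOf cs) → ∀ {y ys} → ups (map send cs) ≡ y ∷ ys →
                                 Dependent G (upAtoms cs)
  upAtoms-of-circuit-dependent cs circuit@(_ , _ , rank , _) has-ups =
    ℕ.+-cancelʳ-< (length Ds) _ _ (begin-strict
      ρ (⋁[ G ] Es) + length Ds        ≤⟨ ℕ.+-mono-≤ ρ⋁Es≤ρ[G∨X] (downAtoms-of-circuit-≤ρ∧ cs circuit has-ups) ⟩
      ρ (G ∨ X) + ρ (G ∧ₗ X)           ≡⟨ ℕ.+-comm (ρ (G ∨ X)) _ ⟩
      ρ (G ∧ₗ X) + ρ (G ∨ X)           ≤⟨ semimodular G X ⟩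
      ρ G + ρ X                        <⟨ ℕ.+-monoʳ-< (ρ G) (ℕ.n<1+n (ρ X)) ⟩
      ρ G + suc (ρ X)                  ≡⟨ cong (ρ G +_) ρX+1≡|Es|+|Ds| ⟩
      ρ G + (length Es + length Ds)    ≡⟨ sym (ℕ.+-assoc (ρ G) _ _) ⟩
      ρ G + length Es + length Ds      ∎)
    where
      open ℕ.≤-Reasoning
      Es = upAtoms cs
      Ds = downAtoms cs
      X  = ⋁ (atomsOf cs)
      ρX+1≡|Es|+|Ds| : suc (ρ X) ≡ length Es + length Ds
      ρX+1≡|Es|+|Ds| = trans (ℕ.+-comm 1 (ρ X))
        (trans rank (trans (cong (_+ length (atomsOf cs)) ρ-bot) (sym (length-upAtoms+downAtoms cs))))
      ρ⋁Es≤ρ[G∨X] : ρ (⋁[ G ] Es) ≤ ρ (G ∨ X)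
      ρ⋁Es≤ρ[G∨X] = ρ-mono _ _ (⋁-least G Es (G ∨ X) (∨-ubˡ G X) (ups-send-≤ cs (G ∨ X) (∨-ubˡ G X)
        (All.tabulate (λ H∈ → ≤-trans _ _ _ (∈⇒≤⋁ bot (atomsOf cs) H∈) (∨-ubʳ G X)))))

  Null-of-dependent : ∀ n (t : List (AtomUp G)) → length t ≤ n → Dependent G (map proj₁ t) → Null (map inj₁ t)
  Null-of-dependent n       []       _          dep = ⊥-elim (¬Dependent[] G dep)
  Null-of-dependent (suc n) (x ∷ t₀) (s≤s |t₀|≤n) dep with duplicate-or-Unique proj₁ _≟ᶠ_ (x ∷ t₀)
  ... | inj₁ (a , a′ , a≡a′ , aa′⊆t) =
    Null-⊆ [] (⊆-map⁺ inj₁ aa′⊆t) (Null-square (inj₁ a) (inj₁ a′) (≡⇒eqΣ {G ⋖_} {a} {a′} a≡a′))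
  ... | inj₂ uniq with any? (λ s → length s <? length (x ∷ t₀) ×-dec dependent? G (map proj₁ s)) (sublists (x ∷ t₀))
  ...   | yes smaller =
    let s , s∈ , |s|<|t| , s-dep = find smaller
    in Null-⊆ [] (⊆-map⁺ inj₁ (∈-sublists⁻ (x ∷ t₀) s∈))
         (Null-of-dependent n s (ℕ.≤-trans (ℕ.≤-pred |s|<|t|) |t₀|≤n) s-dep)
  ...   | no minimal =
    Null-of-InI-delta (inj₁ x) (map inj₁ t₀) (InI-generator (inj₂ (inj₁ (x ∷ t₀ , circuit , refl))))
    where
      circuit : IsCircuitFrom G (map proj₁ (x ∷ t₀))
      circuit = minimal-dependent⇒circuit G _ uniq (All-map⁺ (All.universal proj₂ (x ∷ t₀))) dep
        λ s′ s′⊆ |s′|< s′-dep →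
          let s , s⊆t , s↦s′ = ⊆-map⁻ proj₁ (x ∷ t₀) s′⊆
          in minimal (lose (∈-sublists⁺ s⊆t)
               (subst₂ _<_ (trans (cong length (sym s↦s′)) (List.length-map proj₁ s))
                           (List.length-map proj₁ (x ∷ t₀)) |s′|< ,
                subst (Dependent G) (sym s↦s′) s′-dep))

  InI-delta-image-of-circuit : ∀ cs → IsCircuitFrom bot (atomsOf cs) → InI (delta (map send cs))
  InI-delta-image-of-circuit cs circuit with ups (map send cs) in ups≡
  ... | [] =
    let same-words , same-atoms = no-ups⇒all-below cs ups≡
    in subst (λ w → InI (delta w)) same-words
         (InI-generator (inj₂ (inj₂ (downs (map send cs) , subst (IsCircuitFrom bot) (sym same-atoms) circuit , refl))))
  ... | y ∷ ys =
    proj₂ (Null-⊆ [] (subst (λ u → map inj₁ u ⊆ map send cs) ups≡ (ups-⊆ (map send cs)))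
                     (Null-of-dependent _ (y ∷ ys) ℕ.≤-refl
                       (subst (λ u → Dependent G (map proj₁ u)) ups≡ (upAtoms-of-circuit-dependent cs circuit ups≡))))

  InI-image-of-relation : ∀ g → SrcRel g → InI (φG g)
  InI-image-of-relation _ (inj₁ (inj₁ (a , b , refl))) = InI-anticommutator (send a) (send b)
  InI-image-of-relation _ (inj₁ (inj₂ (a , refl)))     = InI-square (send a)
  InI-image-of-relation _ (inj₂ (cs , circuit , refl)) = subst InI (sym (φ-delta cs)) (InI-delta-image-of-circuit cs circuit)

  φ-preserves-ideal : ∀ p → InIdealSrc p → InIdealTgt G (φG p)
  φ-preserves-ideal p (ts , relations , p≐ts) =
    InI-resp-≐ {φG p} {φG (Free.combine AtomL ts)} (φ-cong p (Free.combine AtomL ts) p≐ts)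
      (subst InI (sym (φ-combine ts))
        (InI-combine (map φTerm ts) (All-map⁺ (All.map (λ {t} → InI-image-of-relation (Free.genOf AtomL t)) relations))))

mainTheorem12 : (L : RawLattice) (geo : IsGeometric L) (𝒢 : Notions.Elt L → Set)
    → Notions.IsIrreducibleBuildingSet L 𝒢
    → (G : Notions.Elt L) → 𝒢 G → G ≢ top L
    → (p : Free.Poly (OSMap.AtomL L))
    → OSMap.InIdealSrc L p
    → OSMap.InIdealTgt L G (OSMap.φ L geo G p)
mainTheorem12 L geo 𝒢 _ G _ _ = SendMap.φ-preserves-ideal L geo G
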